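{- For every $k\in\mathbb{N}$ and every circular drawing $D$ of $K_{2,4k-1}$, the crossing graph $X_D$ contains $K_{k,k}$ as a subgraph.
   Context: A circular drawing of a graph $G$ places the vertices at distinct points on a circle and draws each edge as the straight line segment between its endpoints. Two edges cross if their segments intersect at a point that is not an endpoint of either. The crossing graph $X_D$ has vertex set $E(G)$, two edges adjacent iff they cross in $D$. -}

module Defs where

open import Data.Nat using (ℕ; _<_; _∸_; _*_)
open import Data.Fin using (Fin)
open import Data.Sum using (_⊎_; inj₁; inj₂)
open import Data.Product using (_×_; Σ; _,_; ∃-syntax)
open import Relation.Nullary using (¬_)
open import Relation.Binary.PropositionalEquality using (_≡_; _≢_)
open import Function.Definitions using (Injective)

KVertex : ℕ → ℕ → Set
KVertex a b = Fin a ⊎ Fin b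

KEdge : ℕ → ℕ → Set
KEdge a b = Fin a × Fin b

endL : ∀ {a b} → KEdge a b → KVertex a b
endL (i , _) = inj₁ i

endR : ∀ {a b} → KEdge a b → KVertex a b
endR (_ , j) = inj₂ j

-- A circular drawing of K_{a,b}: the vertices are placed at distinct
-- points of a circle.  Up to the combinatorics relevant for crossings,
-- such a placement is given by the cyclic order of the points, which we
-- encode by an injective labelling of the vertices with natural numbers
-- (reading the circle counter-clockwise from a fixed base point).
record CircularDrawing (a b : ℕ) : Set where
  field
    pos    : KVertex a b → ℕ
    pos-inj : Injective _≡_ _≡_ pos
open CircularDrawing public

-- z lies strictly between x and y on the line (i.e. on one of the two arcs
-- cut out by the points x and y on the circle).
Between : ℕ → ℕ → ℕ → Set
Between x y z = (x < z × z < y) ⊎ (y < z × z < x)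

-- Straight chords pq and rs between points on a circle cross (at a point
-- that is not an endpoint of either) iff the four endpoints are distinct and
-- exactly one of r, s lies on each of the arcs determined by p and q.
ChordsCross : ℕ → ℕ → ℕ → ℕ → Set
ChordsCross p q r s =
  p ≢ r × p ≢ s × q ≢ r × q ≢ s ×
  ((Between p q r × ¬ Between p q s) ⊎ (¬ Between p q r × Between p q s))

Cross : ∀ {a b} → CircularDrawing a b → KEdge a b → KEdge a b → Set
Cross D e f =
  ChordsCross (pos D (endL e)) (pos D (endR e)) (pos D (endL f)) (pos D (endR f))

ContainsKkk : ∀ {a b} → CircularDrawing a b → ℕ → Set
ContainsKkk {a} {b} D k =
  Σ (Fin k → KEdge a b) λ f →
  Σ (Fin k → KEdge a b) λ g →
    Injective _≡_ _≡_ f × Injective _≡_ _≡_ g ×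
    (∀ i j → f i ≢ g j) ×
    (∀ i j → Cross D (f i) (g j))

{-# OPTIONS --safe #-}
module Submission where

-- The two centres cut the circle into two arcs and every leaf lies on one of them, so one arc,
-- say the one running from centre c to centre c′, carries at least 2k of the 4k − 1 leaves.
-- Let v₁, …, v₂ₖ be the first 2k of them in the order met along that arc. For i ≤ k < j the
-- points c, vᵢ, vⱼ, c′ occur in this cyclic order, so the chord c vⱼ separates vᵢ from c′ and
-- crosses the chord c′ vᵢ: the edges c vⱼ (j > k) and c′ vᵢ (i ≤ k) span a K_{k,k} in X_D.

open import Defs
open import Data.Nat using (ℕ; _≤_; _∸_; _*_; suc; _+_; _<_; _<?_; _≤?_; z≤n; s≤s; s<s)
open import Data.Nat.Properties
open import Data.Fin as Fin using (Fin; toℕ; inject≤; _↑ˡ_; _↑ʳ_)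
open import Data.Fin.Patterns using (0F; 1F)
open import Data.Fin.Properties
  using (toℕ-inject≤; toℕ-↑ˡ; toℕ-↑ʳ; ↑ˡ-injective; ↑ʳ-injective; toℕ<n) renaming (<-cmp to <-cmpᶠ)
open import Data.List using (List; []; _∷_; length; filter; lookup; allFin; _++_)
open import Data.List.Properties using (length-tabulate; filter-accept; filter-reject)
open import Data.List.Membership.Propositional.Properties using (∈-lookup)
open import Data.List.Relation.Unary.All as All using (All; []; _∷_)
open import Data.List.Relation.Unary.All.Properties using (all-filter)
open import Data.List.Relation.Unary.AllPairs as AllPairs using (AllPairs; []; _∷_)
import Data.List.Relation.Unary.AllPairs.Properties as AllPairs
open import Data.List.Relation.Unary.Unique.Propositional.Properties using (allFin⁺)
open import Data.List.Relation.Unary.Sorted.TotalOrder.Properties using (Sorted⇒AllPairs)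
open import Data.List.Relation.Binary.Permutation.Propositional
  using (_↭_; ↭-refl; ↭-sym; ↭-prep; ↭⇒↭ₛ; module PermutationReasoning)
open import Data.List.Relation.Binary.Permutation.Propositional.Properties
  using (↭-length; filter-↭; shift)
import Data.List.Relation.Binary.Permutation.Setoid.Properties as Permutationₛ
open import Data.Nat.Tactic.RingSolver using (solve-∀)
open import Data.Product using (_×_; _,_; proj₁; proj₂)
open import Data.Sum using (_⊎_; inj₁; inj₂; [_,_])
open import Data.Sum.Properties using (inj₂-injective)
import Data.Sum as Sum
open import Function using (_∘_; id; flip; _on_)
open import Function.Definitions using (Injective)
open import Level using (Level; _⊔_; 0ℓ)
open import Relation.Binary using (DecTotalOrder; Rel; Irreflexive; _Preserves_⟶_; tri<; tri≈; tri>)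
import Relation.Binary.Construct.On as On
open import Relation.Binary.PropositionalEquality
  using (_≡_; _≢_; refl; sym; trans; cong; cong₂; ≢-sym; setoid; resp₂)
open import Relation.Nullary using (¬_; Dec; yes; no; contradiction)
open import Relation.Nullary.Decidable using (_×-dec_; _⊎-dec_)
open import Relation.Unary using (Pred; Decidable)

private
  variable
    a b ℓ ℓ′ p q : Level
    A : Set a
    B : Set b
    k : ℕ

record Biclique {A : Set a} (R : Rel A ℓ) (k : ℕ) : Set (a ⊔ ℓ) where
  field
    left right      : Fin k → A
    left-injective  : Injective _≡_ _≡_ left
    right-injective : Injective _≡_ _≡_ right
    related         : ∀ i j → R (left i) (right j)

Biclique-swap : {R : Rel A ℓ} → Biclique R k → Biclique (flip R) k
Biclique-swap K = record
  { left = right ; right = left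
  ; left-injective = right-injective ; right-injective = left-injective
  ; related = flip related }
  where open Biclique K

Biclique-map : {R : Rel A ℓ} {S : Rel B ℓ′} (φ ψ : A → B) →
               Injective _≡_ _≡_ φ → Injective _≡_ _≡_ ψ →
               (∀ {x y} → R x y → S (φ x) (ψ y)) → Biclique R k → Biclique S k
Biclique-map φ ψ φ-inj ψ-inj R⇒S K = record
  { left = φ ∘ left ; right = ψ ∘ right
  ; left-injective = left-injective ∘ φ-inj
  ; right-injective = right-injective ∘ ψ-inj
  ; related = λ i j → R⇒S (related i j) }
  where open Biclique K

module _ {R : Rel A ℓ} (R-irrefl : Irreflexive _≡_ R) where

  increasing⇒injective : ∀ {m} {e : Fin m → A} → e Preserves Fin._<_ ⟶ R → Injective _≡_ _≡_ e
  increasing⇒injective {e = e} e-incr {i} {j} eᵢ≡eⱼ with <-cmpᶠ i j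
  ... | tri< i<j _ _ = contradiction (e-incr i<j) (R-irrefl eᵢ≡eⱼ)
  ... | tri≈ _ i≡j _ = i≡j
  ... | tri> _ _ j<i = contradiction (e-incr j<i) (R-irrefl (sym eᵢ≡eⱼ))

  increasing⇒Biclique : {e : Fin (k + k) → A} → e Preserves Fin._<_ ⟶ R → Biclique R k
  increasing⇒Biclique {k} {e} e-incr = record
    { left = e ∘ (_↑ˡ k) ; right = e ∘ (k ↑ʳ_)
    ; left-injective = ↑ˡ-injective k _ _ ∘ e-injective
    ; right-injective = ↑ʳ-injective k _ _ ∘ e-injective
    ; related = λ i j → e-incr (↑ˡ<↑ʳ i j) }
    where
      e-injective : Injective _≡_ _≡_ e
      e-injective = increasing⇒injective e-incr
      ↑ˡ<↑ʳ : ∀ i j → i ↑ˡ k Fin.< k ↑ʳ j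
      ↑ˡ<↑ʳ i j rewrite toℕ-↑ˡ i k | toℕ-↑ʳ k j = <-≤-trans (toℕ<n i) (m≤m+n k (toℕ j))

lookup-increasing : {R : Rel A ℓ} {xs : List A} → AllPairs R xs → lookup xs Preserves Fin._<_ ⟶ R
lookup-increasing (R-head ∷ _) {Fin.zero} {Fin.suc j} _ = All.lookup R-head (∈-lookup j)
lookup-increasing (_ ∷ R-tail) {Fin.suc i} {Fin.suc j} (s<s i<j) = lookup-increasing R-tail i<j

sorted⇒Biclique : {R : Rel A ℓ} {xs : List A} → Irreflexive _≡_ R →
                  AllPairs R xs → k + k ≤ length xs → Biclique R k
sorted⇒Biclique R-irrefl sorted 2k≤len =
  increasing⇒Biclique R-irrefl (λ {i} {j} i<j → lookup-increasing sorted (inject≤-mono i j i<j))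
  where
    inject≤-mono : ∀ i j → i Fin.< j → inject≤ i 2k≤len Fin.< inject≤ j 2k≤len
    inject≤-mono i j i<j rewrite toℕ-inject≤ i 2k≤len | toℕ-inject≤ j 2k≤len = i<j

module _ {P : Pred A p} (P? : Decidable P) where

  filter-sorted : {R : Rel A ℓ} {xs : List A} → AllPairs R xs →
                  AllPairs (λ x y → P x × P y × R x y) (filter P? xs)
  filter-sorted {xs = xs} sorted = restrict (all-filter P? xs) (AllPairs.filter⁺ P? sorted)
    where
      restrict : ∀ {R : Rel A ℓ} {ys} → All P ys → AllPairs R ys →
                 AllPairs (λ x y → P x × P y × R x y) ys
      restrict []         []         = []
      restrict (px ∷ pys) (rx ∷ rys) =
        All.zipWith (λ (py , r) → px , py , r) (pys , rx) ∷ restrict pys rys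

  length≤filter+filter : {Q : Pred A q} (Q? : Decidable Q) {xs : List A} →
                         All (λ x → P x ⊎ Q x) xs →
                         length xs ≤ length (filter P? xs) + length (filter Q? xs)
  length≤filter+filter Q? [] = z≤n
  length≤filter+filter Q? {x ∷ xs} (px⊎qx ∷ P∪Q)
    with ih ← length≤filter+filter Q? P∪Q | P? x | Q? x
  ... | yes _  | yes _  = s≤s (≤-trans ih (+-monoʳ-≤ _ (n≤1+n _)))
  ... | yes _  | no _   = s≤s ih
  ... | no _   | yes _  = ≤-trans (s≤s ih) (≤-reflexive (sym (+-suc _ _)))
  ... | no ¬px | no ¬qx = contradiction px⊎qx [ ¬px , ¬qx ]

module _ {A : Set a} (key : A → ℕ) where
  private
    keyOrder : DecTotalOrder a 0ℓ 0ℓ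
    keyOrder = On.decTotalOrder ≤-decTotalOrder key

  open import Data.List.Sort keyOrder public using (sort; sort-↭)
  open import Data.List.Sort keyOrder using (sort-↗)

  sort-strictlySorted : {xs : List A} → AllPairs (λ x y → key x ≢ key y) xs →
                        AllPairs (_<_ on key) (sort xs)
  sort-strictlySorted {xs} distinct =
    AllPairs.zipWith (λ (x≤y , x≢y) → ≤∧≢⇒< x≤y x≢y) (sorted , sorted-distinct)
    where
      sorted : AllPairs (λ x y → key x ≤ key y) (sort xs)
      sorted = Sorted⇒AllPairs (DecTotalOrder.totalOrder keyOrder) (sort-↗ xs)
      sorted-distinct : AllPairs (λ x y → key x ≢ key y) (sort xs)
      sorted-distinct = Permutationₛ.AllPairs-resp-↭ (setoid A) {R = λ x y → key x ≢ key y}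
                          ≢-sym (resp₂ _) (↭⇒↭ₛ (↭-sym (sort-↭ xs))) distinct

-- Going round the circle in the direction of increasing labels, one meets x, y, z in this order.
Cyclic : ℕ → ℕ → ℕ → Set
Cyclic x y z = (x < y × y < z) ⊎ (y < z × z < x) ⊎ (z < x × x < y)

Cyclic? : ∀ x y z → Dec (Cyclic x y z)
Cyclic? x y z = (x <? y ×-dec y <? z) ⊎-dec (y <? z ×-dec z <? x) ⊎-dec (z <? x ×-dec x <? y)

module _ {x y z : ℕ} where

  Cyclic-rotate : Cyclic x y z → Cyclic y z x
  Cyclic-rotate (inj₁ xyz)        = inj₂ (inj₂ xyz)
  Cyclic-rotate (inj₂ (inj₁ yzx)) = inj₁ yzx
  Cyclic-rotate (inj₂ (inj₂ zxy)) = inj₂ (inj₁ zxy)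

  Cyclic⇒≢ : Cyclic x y z → x ≢ y
  Cyclic⇒≢ (inj₁ (x<y , _))         = <⇒≢ x<y
  Cyclic⇒≢ (inj₂ (inj₁ (y<z , z<x))) = >⇒≢ (<-trans y<z z<x)
  Cyclic⇒≢ (inj₂ (inj₂ (_ , x<y)))   = <⇒≢ x<y

  Cyclic-connex : x ≢ y → y ≢ z → z ≢ x → Cyclic x y z ⊎ Cyclic z y x
  Cyclic-connex x≢y y≢z z≢x with <-cmp x y | <-cmp y z | <-cmp z x
  ... | tri≈ _ x≡y _ | _            | _            = contradiction x≡y x≢y
  ... | _            | tri≈ _ y≡z _ | _            = contradiction y≡z y≢z
  ... | _            | _            | tri≈ _ z≡x _ = contradiction z≡x z≢x
  ... | tri< x<y _ _ | tri< y<z _ _ | _            = inj₁ (inj₁ (x<y , y<z))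
  ... | tri> _ _ y<x | tri> _ _ z<y | _            = inj₂ (inj₁ (z<y , y<x))
  ... | tri< x<y _ _ | tri> _ _ _   | tri< z<x _ _ = inj₁ (inj₂ (inj₂ (z<x , x<y)))
  ... | tri< _ _ _   | tri> _ _ z<y | tri> _ _ x<z = inj₂ (inj₂ (inj₂ (x<z , z<y)))
  ... | tri> _ _ _   | tri< y<z _ _ | tri< z<x _ _ = inj₁ (inj₂ (inj₁ (y<z , z<x)))
  ... | tri> _ _ y<x | tri< _ _ _   | tri> _ _ x<z = inj₂ (inj₂ (inj₁ (y<x , x<z)))

Between-sym : ∀ {x y z} → Between x y z → Between y x z
Between-sym = Sum.swap

module _ {p z q : ℕ} where

  Cyclic⇒Between : Cyclic p z q → p < q → Between p q z
  Cyclic⇒Between (inj₁ pzq)               _   = inj₁ pzq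
  Cyclic⇒Between (inj₂ (inj₁ (_ , q<p))) p<q = contradiction q<p (<-asym p<q)
  Cyclic⇒Between (inj₂ (inj₂ (q<p , _))) p<q = contradiction q<p (<-asym p<q)

  Cyclic⇒¬Between : Cyclic p z q → q < p → ¬ Between p q z
  Cyclic⇒¬Between _                       q<p (inj₁ (p<z , z<q)) = <-asym q<p (<-trans p<z z<q)
  Cyclic⇒¬Between (inj₁ (p<z , _))        _   (inj₂ (_ , z<p))   = <-asym p<z z<p
  Cyclic⇒¬Between (inj₂ (inj₁ (z<q , _))) _   (inj₂ (q<z , _))   = <-asym z<q q<z
  Cyclic⇒¬Between (inj₂ (inj₂ (_ , p<z))) _   (inj₂ (_ , z<p))   = <-asym p<z z<p

chords-cross : ∀ {p q r s} → Cyclic p s q → Cyclic q r p → ChordsCross p q r s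
chords-cross {p} {q} {r} {s} cs cr =
  ≢-sym (Cyclic⇒≢ (Cyclic-rotate cr)) , Cyclic⇒≢ cs ,
  Cyclic⇒≢ cr , ≢-sym (Cyclic⇒≢ (Cyclic-rotate cs)) , exactlyOne
  where
    exactlyOne : (Between p q r × ¬ Between p q s) ⊎ (¬ Between p q r × Between p q s)
    exactlyOne with <-cmp p q
    ... | tri< p<q _ _ = inj₂ (Cyclic⇒¬Between cr p<q ∘ Between-sym , Cyclic⇒Between cs p<q)
    ... | tri≈ _ p≡q _ = contradiction p≡q (Cyclic⇒≢ (Cyclic-rotate (Cyclic-rotate cr)))
    ... | tri> _ _ q<p = inj₁ (Between-sym (Cyclic⇒Between cr q<p) , Cyclic⇒¬Between cs q<p)

module _ {A : Set a} (key : A → ℕ) where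

  above? : ∀ c → Decidable (λ x → c < key x)
  above? c x = c <? key x

  below? : ∀ c → Decidable (λ x → key x < c)
  below? c x = key x <? c

  rotate : ℕ → List A → List A
  rotate c xs = filter (above? c) xs ++ filter (below? c) xs

  rotate-sorted : ∀ {c xs} → AllPairs (_<_ on key) xs →
                  AllPairs (λ x y → Cyclic c (key x) (key y)) (rotate c xs)
  rotate-sorted {c} {xs} sorted = AllPairs.++⁺
    (AllPairs.map (λ (c<x , _ , x<y) → inj₁ (c<x , x<y)) (filter-sorted (above? c) sorted))
    (AllPairs.map (λ (_ , y<c , x<y) → inj₂ (inj₁ (x<y , y<c))) (filter-sorted (below? c) sorted))
    (All.map (λ c<x → All.map (λ y<c → inj₂ (inj₂ (y<c , c<x))) (all-filter (below? c) xs))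
             (all-filter (above? c) xs))

  rotate-↭ : ∀ {c xs} → All (λ x → key x ≢ c) xs → rotate c xs ↭ xs
  rotate-↭ [] = ↭-refl
  rotate-↭ {c} {x ∷ xs} (x≢c ∷ xs≢c) with <-cmp (key x) c
  ... | tri< x<c _ _ = begin
    rotate c (x ∷ xs)
      ≡⟨ cong₂ _++_ (filter-reject (above? c) (<⇒≯ x<c)) (filter-accept (below? c) x<c) ⟩
    filter (above? c) xs ++ (x ∷ filter (below? c) xs)  ↭⟨ shift x _ _ ⟩
    (x ∷ rotate c xs)                                   ↭⟨ ↭-prep x (rotate-↭ xs≢c) ⟩
    (x ∷ xs)                                            ∎
    where open PermutationReasoning
  ... | tri≈ _ x≡c _ = contradiction x≡c x≢c
  ... | tri> _ _ c<x = begin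
    rotate c (x ∷ xs)
      ≡⟨ cong₂ _++_ (filter-accept (above? c) c<x) (filter-reject (below? c) (<⇒≯ c<x)) ⟩
    (x ∷ rotate c xs)  ↭⟨ ↭-prep x (rotate-↭ xs≢c) ⟩
    (x ∷ xs)           ∎
    where open PermutationReasoning

  ArcBefore : ℕ → ℕ → Rel A 0ℓ
  ArcBefore c d x y = Cyclic c (key x) d × Cyclic c (key y) d × Cyclic c (key x) (key y)

  ArcBefore-irrefl : ∀ {c d} → Irreflexive _≡_ (ArcBefore c d)
  ArcBefore-irrefl refl (_ , _ , x-before-x) = Cyclic⇒≢ (Cyclic-rotate x-before-x) refl

  arc : ℕ → ℕ → List A → List A
  arc c d xs = filter (λ x → Cyclic? c (key x) d) (rotate c xs)

  arc-sorted : ∀ {c d xs} → AllPairs (_<_ on key) xs → AllPairs (ArcBefore c d) (arc c d xs)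
  arc-sorted = filter-sorted _ ∘ rotate-sorted

  arcs-cover : ∀ {c d} xs → c ≢ d → All (λ x → key x ≢ c × key x ≢ d) xs →
               length xs ≤ length (arc c d xs) + length (arc d c xs)
  arcs-cover {c} {d} xs c≢d away = begin
    length xs
      ≤⟨ length≤filter+filter _ _ (All.map onSomeArc away) ⟩
    length (filter (λ x → Cyclic? c (key x) d) xs) + length (filter (λ x → Cyclic? d (key x) c) xs)
      ≡⟨ sym (cong₂ _+_ (length-arc (All.map proj₁ away)) (length-arc (All.map proj₂ away))) ⟩
    length (arc c d xs) + length (arc d c xs) ∎
    where
      open ≤-Reasoning
      onSomeArc : ∀ {x} → key x ≢ c × key x ≢ d → Cyclic c (key x) d ⊎ Cyclic d (key x) c
      onSomeArc (x≢c , x≢d) = Cyclic-connex (≢-sym x≢c) x≢d (≢-sym c≢d)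
      length-arc : ∀ {c′ d′} → All (λ x → key x ≢ c′) xs →
                   length (arc c′ d′ xs) ≡ length (filter (λ x → Cyclic? c′ (key x) d′) xs)
      length-arc away = ↭-length (filter-↭ _ (rotate-↭ away))

Cross-irrefl : ∀ {a b} (D : CircularDrawing a b) → Irreflexive _≡_ (Cross D)
Cross-irrefl D refl (p≢p , _) = p≢p refl

Biclique⇒ContainsKkk : ∀ {a b} (D : CircularDrawing a b) → Biclique (Cross D) k → ContainsKkk D k
Biclique⇒ContainsKkk D K =
  left , right , left-injective , right-injective ,
  (λ i j eq → Cross-irrefl D eq (related i j)) , related
  where open Biclique K

module _ {n} (D : CircularDrawing 2 n) where

  centre : Fin 2 → ℕ
  centre c = pos D (inj₁ c)

  leaf : Fin n → ℕ
  leaf u = pos D (inj₂ u)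

  leaf≢centre : ∀ u c → leaf u ≢ centre c
  leaf≢centre u c eq with pos-inj D eq
  ... | ()

  centre₀≢centre₁ : centre 0F ≢ centre 1F
  centre₀≢centre₁ eq with pos-inj D eq
  ... | ()

  leaves : List (Fin n)
  leaves = sort leaf (allFin n)

  leaves-sorted : AllPairs (_<_ on leaf) leaves
  leaves-sorted =
    sort-strictlySorted leaf (AllPairs.map (λ u≢v → u≢v ∘ inj₂-injective ∘ pos-inj D) (allFin⁺ n))

  length-leaves : length leaves ≡ n
  length-leaves = trans (↭-length (sort-↭ leaf (allFin n))) (length-tabulate id)

  arcs-cover-leaves : n ≤ length (arc leaf (centre 0F) (centre 1F) leaves)
                        + length (arc leaf (centre 1F) (centre 0F) leaves)
  arcs-cover-leaves = ≤-trans (≤-reflexive (sym length-leaves))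
    (arcs-cover leaf leaves centre₀≢centre₁
      (All.tabulate (λ {u} _ → leaf≢centre u 0F , leaf≢centre u 1F)))

  arc-ContainsKkk : ∀ c c′ → k + k ≤ length (arc leaf (centre c) (centre c′) leaves) →
                    ContainsKkk D k
  arc-ContainsKkk c c′ big =
    Biclique⇒ContainsKkk D (Biclique-map (c ,_) (c′ ,_) (cong proj₂) (cong proj₂) crosses
      (Biclique-swap (sorted⇒Biclique (ArcBefore-irrefl leaf) (arc-sorted leaf leaves-sorted) big)))
    where
      crosses : ∀ {u v} → ArcBefore leaf (centre c) (centre c′) v u → Cross D (c , u) (c′ , v)
      crosses (_ , u-on-arc , v-before-u) = chords-cross v-before-u (Cyclic-rotate u-on-arc)

≤-halves : ∀ m p q → m + m ≤ suc (p + q) → m ≤ p ⊎ m ≤ q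
≤-halves m p q m+m≤ with m ≤? p
... | yes m≤p = inj₁ m≤p
... | no m≰p  = inj₂ (+-cancelˡ-≤ m _ _ (≤-trans m+m≤ (+-monoˡ-≤ q (≰⇒> m≰p))))

4k∸1≤⇒2k≤⊎2k≤ : ∀ k {p q} → 4 * k ∸ 1 ≤ p + q → k + k ≤ p ⊎ k + k ≤ q
4k∸1≤⇒2k≤⊎2k≤ k {p} {q} 4k∸1≤p+q = ≤-halves (k + k) p q (begin
  (k + k) + (k + k) ≡⟨ 2k+2k≡4k k ⟩
  4 * k             ≤⟨ m≤n+m∸n (4 * k) 1 ⟩
  suc (4 * k ∸ 1)   ≤⟨ s≤s 4k∸1≤p+q ⟩
  suc (p + q)       ∎)
  where
    open ≤-Reasoning
    2k+2k≡4k : ∀ k → (k + k) + (k + k) ≡ 4 * k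
    2k+2k≡4k = solve-∀

proposition14 : (k : ℕ) → 1 ≤ k → (D : CircularDrawing 2 (4 * k ∸ 1)) →
    ContainsKkk D k
proposition14 k _ D with 4k∸1≤⇒2k≤⊎2k≤ k (arcs-cover-leaves D)
... | inj₁ big = arc-ContainsKkk D 0F 1F big
... | inj₂ big = arc-ContainsKkk D 1F 0F big
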